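{- Let $\frac12 Q_{24}$ denote the graph whose vertices are the binary words of length $24$ with an even number of ones, two words being adjacent iff they differ in exactly two positions (a regular graph of degree $276$). For each $c\in\{3,6,8,9,11,12\}\cup\{14,15,\dots,128\}$ there exists a perfect coloring of $\frac12 Q_{24}$ with parameters $((20+c,256-c)(c,276-c))$.
   Context: A perfect coloring of a simple graph $G$ with colour set $I$ and parameter matrix $(s_{ij})_{i,j\in I}$ is a surjective map $T:V(G)\to I$ such that for all $i,j\in I$ every vertex of colour $i$ has exactly $s_{ij}$ neighbours of colour $j$. For two colours the matrix is written $((a,b)(c,d))$: a vertex of the first colour has $a$ neighbours of the first colour and $b$ of the second, and a vertex of the second colour has $c$ neighbours of the first colour and $d$ of the second. Equivalently, such a coloring is the characteristic function of a set $C\subset V(G)$ (first colour $=1$, i.e. in $C$; second colour $=0$): every vertex of $C$ has exactly $a$ neighbours in $C$, and every vertex outside $C$ has exactly $c$ neighbours in $C$. -}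

module Defs where

open import Data.Bool using (Bool; true; false; _∧_; not; if_then_else_)
open import Data.Nat using (ℕ; zero; suc; _+_; _%_; _≡ᵇ_)
open import Data.List using (List; []; _∷_; map; _++_; length; filterᵇ)
open import Data.Vec using (Vec; []; _∷_)
open import Data.Product using (Σ; _×_; ∃)
open import Relation.Binary.PropositionalEquality using (_≡_)

weight : ∀ {n} → Vec Bool n → ℕ
weight []            = 0
weight (true  ∷ w) = suc (weight w)
weight (false ∷ w) = weight w

dist : ∀ {n} → Vec Bool n → Vec Bool n → ℕ
dist []       []       = 0
dist (x ∷ u) (y ∷ v) = (if x Data.Bool.xor y then 1 else 0) + dist u v

isEven : ∀ {n} → Vec Bool n → Bool
isEven w = (weight w % 2) ≡ᵇ 0

adjᵇ : ∀ {n} → Vec Bool n → Vec Bool n → Bool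
adjᵇ u v = dist u v ≡ᵇ 2

words : (n : ℕ) → List (Vec Bool n)
words zero    = [] ∷ []
words (suc n) = map (true ∷_) (words n) ++ map (false ∷_) (words n)

hasColour : ∀ {n} → (Vec Bool n → Bool) → Bool → Vec Bool n → Bool
hasColour C true  w = C w
hasColour C false w = not (C w)

nbrCount : ∀ {n} → (Vec Bool n → Bool) → Bool → Vec Bool n → ℕ
nbrCount {n} C j v =
  length (filterᵇ (λ w → isEven w ∧ adjᵇ v w ∧ hasColour C j w) (words n))

-- C (restricted to even-weight words) is a perfect 2-coloring of ½Q_n with
-- parameter matrix ((a,b)(c,d)); colour 1 = true (in C), colour 2 = false.
PerfectColoring2 : (n : ℕ) → (Vec Bool n → Bool) → ℕ → ℕ → ℕ → ℕ → Set
PerfectColoring2 n C a b c d =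
  (Σ (Vec Bool n) λ w → isEven w ≡ true × C w ≡ true) ×
  (Σ (Vec Bool n) λ w → isEven w ≡ true × C w ≡ false) ×
  (∀ v → isEven v ≡ true → C v ≡ true →
     nbrCount C true v ≡ a × nbrCount C false v ≡ b) ×
  (∀ v → isEven v ≡ true → C v ≡ false →
     nbrCount C true v ≡ c × nbrCount C false v ≡ d)

-- The extended Golay code (the kernel of syn golay) has only even words, so ½Q₂₄ folds onto
-- the graph on the 2048 even syndromes in which s is adjacent to s ⊕ syn e for the 276 words e
-- of weight two. A colouring that factors through the syndrome is perfect as soon as its colour
-- class B downstairs is equitable: every syndrome in B has θ + c neighbours in B and every other
-- one has c. Translates of two base sets, the syndromes of the weight-one words (c = 3) and a
-- subspace of 64 syndromes (c = 8), are equitable with the same θ = 20, so disjoint unions of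
-- translates are again equitable, with the values of c adding up. With seven translates of the
-- first kind and sixteen of the second every c = 3b + 8a of the statement is reached.

module Submission where

open import Defs
open import Algebra.Bundles using (CommutativeSemigroup; CommutativeRing)
import Algebra.Properties.CommutativeSemigroup as CommutativeSemigroupProperties
import Data.Bool as Bool
open import Data.Bool using (Bool; true; false; _∧_; _∨_; not; if_then_else_; _xor_; T)
open import Data.Bool.ListAction using (any)
open import Data.Bool.Properties
  using (xor-assoc; xor-comm; xor-same; xor-identityʳ; xor-∧-commutativeRing; ∧-zeroʳ;
         not-involutive; not-injective; T-≡)
open import Data.List using (List; []; _∷_; _++_; map; length; filterᵇ; take; drop)
open import Data.List.Properties using (length-++; filter-++; filter-≐)
open import Data.List.Relation.Binary.Sublist.Propositional using (_⊆_; ⊆-refl)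
open import Data.List.Relation.Binary.Sublist.Propositional.Properties
  using (filter⁺; length-mono-≤; take-⊆; ++⁺)
open import Data.Nat using (ℕ; zero; suc; _+_; _*_; _∸_; _≤_; _<_; _%_; _/_; _≡ᵇ_; _<ᵇ_; _≤ᵇ_; s≤s; s≤s⁻¹)
open import Data.Nat.Combinatorics using (nCk+nC[k+1]≡[n+1]C[k+1]) renaming (_C_ to _choose_)
open import Data.Nat.ListAction using (sum)
open import Data.Nat.Properties
  using (≡ᵇ⇒≡; ≤ᵇ⇒≤; +-comm; +-identityʳ; *-identityˡ; *-identityʳ; *-zeroʳ; *-distribˡ-+; m+n∸n≡m;
         +-commutativeSemigroup; ≤-trans; m≤n⇒m<n∨m≡n; m+[n∸m]≡n; ∸-monoˡ-<)
open import Data.Product using (Σ; _×_; _,_; proj₁; proj₂; map₂)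
open import Data.Sum using (_⊎_; inj₁; inj₂)
import Data.Vec as Vec
open import Data.Vec using (Vec; []; _∷_; head; zipWith; replicate; toList)
open import Data.Vec.Properties using (zipWith-assoc; zipWith-comm; zipWith-identityʳ)
open import Data.Vec.Relation.Unary.All using (All; []; _∷_; all?)
open import Function using (_∘_; Equivalence)
open import Level using (0ℓ)
open import Relation.Binary.PropositionalEquality
open import Relation.Nullary.Decidable using (T?; isYes; toWitness)

⟦_⟧ : Bool → ℕ
⟦ true ⟧ = 1
⟦ false ⟧ = 0

⟦not⟧+⟦⟧ : ∀ b → ⟦ not b ⟧ + ⟦ b ⟧ ≡ 1
⟦not⟧+⟦⟧ true = refl
⟦not⟧+⟦⟧ false = refl

∧≡true : ∀ {a b} → a ∧ b ≡ true → a ≡ true × b ≡ true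
∧≡true {true} b≡true = refl , b≡true

≡ᵇ-sound : ∀ {m n} → (m ≡ᵇ n) ≡ true → m ≡ n
≡ᵇ-sound {m} {n} eq = ≡ᵇ⇒≡ m n (Equivalence.from T-≡ eq)

infixl 6 _⊕_

_⊕_ : ∀ {n} → Vec Bool n → Vec Bool n → Vec Bool n
_⊕_ = zipWith _xor_

𝟘 : ∀ {n} → Vec Bool n
𝟘 = replicate _ false

⊕-assoc : ∀ {n} (u v w : Vec Bool n) → (u ⊕ v) ⊕ w ≡ u ⊕ (v ⊕ w)
⊕-assoc = zipWith-assoc xor-assoc

⊕-comm : ∀ {n} (u v : Vec Bool n) → u ⊕ v ≡ v ⊕ u
⊕-comm = zipWith-comm xor-comm

⊕-identityʳ : ∀ {n} (u : Vec Bool n) → u ⊕ 𝟘 ≡ u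
⊕-identityʳ = zipWith-identityʳ xor-identityʳ

⊕-self : ∀ {n} (u : Vec Bool n) → u ⊕ u ≡ 𝟘
⊕-self [] = refl
⊕-self (x ∷ u) = cong₂ _∷_ (xor-same x) (⊕-self u)

⊕-commutativeSemigroup : ℕ → CommutativeSemigroup 0ℓ 0ℓ
⊕-commutativeSemigroup n = record
  { Carrier = Vec Bool n
  ; _≈_ = _≡_
  ; _∙_ = _⊕_
  ; isCommutativeSemigroup = record
    { isSemigroup = record
      { isMagma = record { isEquivalence = isEquivalence ; ∙-cong = cong₂ _⊕_ }
      ; assoc = ⊕-assoc
      }
    ; comm = ⊕-comm
    }
  }

module ⊕-Properties {n : ℕ} = CommutativeSemigroupProperties (⊕-commutativeSemigroup n)

⊕-cancelˡ : ∀ {n} (c u v : Vec Bool n) → (c ⊕ u) ⊕ (c ⊕ v) ≡ u ⊕ v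
⊕-cancelˡ c u v = begin
  (c ⊕ u) ⊕ (c ⊕ v) ≡⟨ ⊕-Properties.interchange c u c v ⟩
  (c ⊕ c) ⊕ (u ⊕ v) ≡⟨ cong (_⊕ (u ⊕ v)) (⊕-self c) ⟩
  𝟘 ⊕ (u ⊕ v)       ≡⟨ ⊕-comm 𝟘 (u ⊕ v) ⟩
  (u ⊕ v) ⊕ 𝟘       ≡⟨ ⊕-identityʳ (u ⊕ v) ⟩
  u ⊕ v             ∎
  where open ≡-Reasoning

head-⊕ : ∀ {n} (u v : Vec Bool (suc n)) → head (u ⊕ v) ≡ head u xor head v
head-⊕ (x ∷ u) (y ∷ v) = refl

parity : ∀ {n} → Vec Bool n → Bool
parity [] = false
parity (x ∷ w) = x xor parity w

parity-⊕ : ∀ {n} (u v : Vec Bool n) → parity (u ⊕ v) ≡ parity u xor parity v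
parity-⊕ [] [] = refl
parity-⊕ (x ∷ u) (y ∷ v) =
  trans (cong ((x xor y) xor_) (parity-⊕ u v)) (xor-interchange x y (parity u) (parity v))
  where open CommutativeSemigroupProperties (CommutativeRing.+-commutativeSemigroup xor-∧-commutativeRing)
          renaming (interchange to xor-interchange)

-- (suc (suc k)) % 2 reduces to k % 2, so the recursion below is by conversion.
%2≡ᵇ0-suc : ∀ k → (suc k % 2 ≡ᵇ 0) ≡ not (k % 2 ≡ᵇ 0)
%2≡ᵇ0-suc zero = refl
%2≡ᵇ0-suc (suc zero) = refl
%2≡ᵇ0-suc (suc (suc k)) = %2≡ᵇ0-suc k

parity≡not-isEven : ∀ {n} (w : Vec Bool n) → parity w ≡ not (isEven w)
parity≡not-isEven [] = refl
parity≡not-isEven (false ∷ w) = parity≡not-isEven w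
parity≡not-isEven (true ∷ w) = cong not (trans (parity≡not-isEven w) (sym (%2≡ᵇ0-suc (weight w))))

isEven⇒parity≡false : ∀ {n} (w : Vec Bool n) → isEven w ≡ true → parity w ≡ false
isEven⇒parity≡false w ev = trans (parity≡not-isEven w) (cong not ev)

isEven-⊕ : ∀ {n} (u v : Vec Bool n) → isEven u ≡ true → isEven v ≡ true → isEven (u ⊕ v) ≡ true
isEven-⊕ u v eu ev = begin
  isEven (u ⊕ v)                 ≡⟨ sym (not-involutive _) ⟩
  not (not (isEven (u ⊕ v)))     ≡⟨ cong not (sym (parity≡not-isEven (u ⊕ v))) ⟩
  not (parity (u ⊕ v))           ≡⟨ cong not (parity-⊕ u v) ⟩
  not (parity u xor parity v)    ≡⟨ cong₂ (λ a b → not (a xor b)) (isEven⇒parity≡false u eu)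
                                                                   (isEven⇒parity≡false v ev) ⟩
  true                           ∎
  where open ≡-Reasoning

dist-⊕ : ∀ {n} (v e : Vec Bool n) → dist v (v ⊕ e) ≡ weight e
dist-⊕ [] [] = refl
dist-⊕ (true ∷ v) (true ∷ e) = cong suc (dist-⊕ v e)
dist-⊕ (true ∷ v) (false ∷ e) = dist-⊕ v e
dist-⊕ (false ∷ v) (true ∷ e) = cong suc (dist-⊕ v e)
dist-⊕ (false ∷ v) (false ∷ e) = dist-⊕ v e

count : ∀ {A : Set} → (A → Bool) → List A → ℕ
count p xs = length (filterᵇ p xs)

count-∷ : ∀ {A : Set} (p : A → Bool) x xs → count p (x ∷ xs) ≡ ⟦ p x ⟧ + count p xs
count-∷ p x xs with p x
... | true = refl
... | false = refl

count-++ : ∀ {A : Set} (p : A → Bool) xs ys → count p (xs ++ ys) ≡ count p xs + count p ys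
count-++ p xs ys = trans (cong length (filter-++ (T? ∘ p) xs ys)) (length-++ (filterᵇ p xs))

count-map : ∀ {A B : Set} (p : B → Bool) (f : A → B) xs → count p (map f xs) ≡ count (p ∘ f) xs
count-map p f [] = refl
count-map p f (x ∷ xs) with p (f x)
... | true = cong suc (count-map p f xs)
... | false = count-map p f xs

count-cong : ∀ {A : Set} {p q : A → Bool} → (∀ x → p x ≡ q x) → ∀ xs → count p xs ≡ count q xs
count-cong {p = p} {q} p≗q xs =
  cong length (filter-≐ (T? ∘ p) (T? ∘ q) ((λ {x} → subst T (p≗q x)) , λ {x} → subst T (sym (p≗q x))) xs)

count-false : ∀ {A : Set} (xs : List A) → count (λ _ → false) xs ≡ 0
count-false [] = refl
count-false (_ ∷ xs) = count-false xs

count-mono-⊆ : ∀ {A : Set} (p : A → Bool) {xs ys} → xs ⊆ ys → count p xs ≤ count p ys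
count-mono-⊆ p σ = length-mono-≤ (filter⁺ (T? ∘ p) (T? ∘ p) (λ { refl px → px }) σ)

count-words-suc : ∀ {n} (p : Vec Bool (suc n) → Bool) →
  count p (words (suc n)) ≡ count (p ∘ (true ∷_)) (words n) + count (p ∘ (false ∷_)) (words n)
count-words-suc {n} p =
  trans (count-++ p (map (true ∷_) (words n)) (map (false ∷_) (words n)))
        (cong₂ _+_ (count-map p (true ∷_) (words n)) (count-map p (false ∷_) (words n)))

count-words-⊕ : ∀ {n} (v : Vec Bool n) (p : Vec Bool n → Bool) →
  count p (words n) ≡ count (λ e → p (v ⊕ e)) (words n)
count-words-⊕ [] p = count-cong {p = p} {q = λ e → p ([] ⊕ e)} (λ { [] → refl }) (words 0)
count-words-⊕ {suc n} (x ∷ v) p = begin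
  count p (words (suc n))
    ≡⟨ count-words-suc p ⟩
  count (p ∘ (true ∷_)) (words n) + count (p ∘ (false ∷_)) (words n)
    ≡⟨ cong₂ _+_ (count-words-⊕ v (p ∘ (true ∷_))) (count-words-⊕ v (p ∘ (false ∷_))) ⟩
  count (λ e → p (true ∷ v ⊕ e)) (words n) + count (λ e → p (false ∷ v ⊕ e)) (words n)
    ≡⟨ swap-if x ⟩
  count (λ e → p ((x xor true) ∷ v ⊕ e)) (words n) + count (λ e → p ((x xor false) ∷ v ⊕ e)) (words n)
    ≡⟨ count-words-suc (λ e → p ((x ∷ v) ⊕ e)) ⟨
  count (λ e → p ((x ∷ v) ⊕ e)) (words (suc n))
    ∎
  where
  open ≡-Reasoning
  swap-if : ∀ x →
    count (λ e → p (true ∷ v ⊕ e)) (words n) + count (λ e → p (false ∷ v ⊕ e)) (words n) ≡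
    count (λ e → p ((x xor true) ∷ v ⊕ e)) (words n) + count (λ e → p ((x xor false) ∷ v ⊕ e)) (words n)
  swap-if false = refl
  swap-if true = +-comm (count (λ e → p (true ∷ v ⊕ e)) (words n)) _

syn : ∀ {m n} → Vec (Vec Bool m) n → Vec Bool n → Vec Bool m
syn [] [] = 𝟘
syn (c ∷ cs) (x ∷ w) = if x then c ⊕ syn cs w else syn cs w

syn-⊕ : ∀ {m n} (cs : Vec (Vec Bool m) n) (u v : Vec Bool n) → syn cs (u ⊕ v) ≡ syn cs u ⊕ syn cs v
syn-⊕ [] [] [] = sym (⊕-identityʳ 𝟘)
syn-⊕ (c ∷ cs) (false ∷ u) (false ∷ v) = syn-⊕ cs u v
syn-⊕ (c ∷ cs) (false ∷ u) (true ∷ v) =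
  trans (cong (c ⊕_) (syn-⊕ cs u v)) (x∙yz≈y∙xz c (syn cs u) (syn cs v))
  where open ⊕-Properties
syn-⊕ (c ∷ cs) (true ∷ u) (false ∷ v) =
  trans (cong (c ⊕_) (syn-⊕ cs u v)) (sym (⊕-assoc c (syn cs u) (syn cs v)))
syn-⊕ (c ∷ cs) (true ∷ u) (true ∷ v) =
  trans (syn-⊕ cs u v) (sym (⊕-cancelˡ c (syn cs u) (syn cs v)))

head-syn : ∀ {m n} (cs : Vec (Vec Bool (suc m)) n) → All (λ c → head c ≡ true) cs →
  ∀ w → head (syn cs w) ≡ parity w
head-syn [] [] [] = refl
head-syn (c ∷ cs) (hc ∷ hcs) (false ∷ w) = head-syn cs hcs w
head-syn (c ∷ cs) (hc ∷ hcs) (true ∷ w) =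
  trans (head-⊕ c (syn cs w)) (cong₂ _xor_ hc (head-syn cs hcs w))

-- shellSum cs d f t = Σ { f (t ⊕ syn cs e) ∣ e ∈ 𝔽₂ⁿ, weight e = d }.
shellSum : ∀ {m n} → Vec (Vec Bool m) n → ℕ → (Vec Bool m → ℕ) → Vec Bool m → ℕ
shellSum [] zero f t = f t
shellSum [] (suc d) f t = 0
shellSum (c ∷ cs) zero f t = shellSum cs zero f t
shellSum (c ∷ cs) (suc d) f t = shellSum cs d f (t ⊕ c) + shellSum cs (suc d) f t

inShell : ∀ {m n} → Vec (Vec Bool m) n → ℕ → (Vec Bool m → Bool) → Vec Bool m → Vec Bool n → Bool
inShell cs d X t e = (weight e ≡ᵇ d) ∧ X (t ⊕ syn cs e)

count-shell : ∀ {m n} (cs : Vec (Vec Bool m) n) d (X : Vec Bool m → Bool) t →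
  count (inShell cs d X t) (words n) ≡ shellSum cs d (⟦_⟧ ∘ X) t
count-shell [] zero X t =
  trans (count-∷ (inShell [] zero X t) [] []) (trans (+-identityʳ _) (cong (⟦_⟧ ∘ X) (⊕-identityʳ t)))
count-shell [] (suc d) X t = refl
count-shell {n = suc n} (c ∷ cs) zero X t =
  trans (count-words-suc (inShell (c ∷ cs) zero X t))
        (cong₂ _+_ (count-false (words n)) (count-shell cs zero X t))
count-shell {n = suc n} (c ∷ cs) (suc d) X t =
  trans (count-words-suc (inShell (c ∷ cs) (suc d) X t))
        (cong₂ _+_ (trans (count-cong reassociate (words n)) (count-shell cs d X (t ⊕ c)))
                   (count-shell cs (suc d) X t))
  where
  reassociate : ∀ e → inShell (c ∷ cs) (suc d) X t (true ∷ e) ≡ inShell cs d X (t ⊕ c) e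
  reassociate e = cong (λ s → (weight e ≡ᵇ d) ∧ X s) (sym (⊕-assoc t c (syn cs e)))

shellSum-cong : ∀ {m n} (cs : Vec (Vec Bool m) n) d {f g : Vec Bool m → ℕ} →
  (∀ s → f s ≡ g s) → ∀ t → shellSum cs d f t ≡ shellSum cs d g t
shellSum-cong [] zero f≗g t = f≗g t
shellSum-cong [] (suc d) f≗g t = refl
shellSum-cong (c ∷ cs) zero f≗g t = shellSum-cong cs zero f≗g t
shellSum-cong (c ∷ cs) (suc d) f≗g t =
  cong₂ _+_ (shellSum-cong cs d f≗g (t ⊕ c)) (shellSum-cong cs (suc d) f≗g t)

shellSum-+ : ∀ {m n} (cs : Vec (Vec Bool m) n) d (f g : Vec Bool m → ℕ) t →
  shellSum cs d (λ s → f s + g s) t ≡ shellSum cs d f t + shellSum cs d g t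
shellSum-+ [] zero f g t = refl
shellSum-+ [] (suc d) f g t = refl
shellSum-+ (c ∷ cs) zero f g t = shellSum-+ cs zero f g t
shellSum-+ (c ∷ cs) (suc d) f g t =
  trans (cong₂ _+_ (shellSum-+ cs d f g (t ⊕ c)) (shellSum-+ cs (suc d) f g t))
        (+-interchange (shellSum cs d f (t ⊕ c)) _ _ _)
  where open CommutativeSemigroupProperties +-commutativeSemigroup renaming (interchange to +-interchange)

shellSum-const : ∀ {m n} (cs : Vec (Vec Bool m) n) d k t → shellSum cs d (λ _ → k) t ≡ k * (n choose d)
shellSum-const [] zero k t = sym (*-identityʳ k)
shellSum-const [] (suc d) k t = sym (*-zeroʳ k)
shellSum-const (c ∷ cs) zero k t = shellSum-const cs zero k t
shellSum-const {n = suc n} (c ∷ cs) (suc d) k t = begin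
  shellSum cs d (λ _ → k) (t ⊕ c) + shellSum cs (suc d) (λ _ → k) t
    ≡⟨ cong₂ _+_ (shellSum-const cs d k (t ⊕ c)) (shellSum-const cs (suc d) k t) ⟩
  k * (n choose d) + k * (n choose suc d)
    ≡⟨ *-distribˡ-+ k (n choose d) (n choose suc d) ⟨
  k * (n choose d + n choose suc d)
    ≡⟨ cong (k *_) (nCk+nC[k+1]≡[n+1]C[k+1] n d) ⟩
  k * (suc n choose suc d)
    ∎
  where open ≡-Reasoning

shellSum-translate : ∀ {m n} (cs : Vec (Vec Bool m) n) d (f : Vec Bool m → ℕ) τ t →
  shellSum cs d (λ s → f (s ⊕ τ)) t ≡ shellSum cs d f (t ⊕ τ)
shellSum-translate [] zero f τ t = refl
shellSum-translate [] (suc d) f τ t = refl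
shellSum-translate (c ∷ cs) zero f τ t = shellSum-translate cs zero f τ t
shellSum-translate (c ∷ cs) (suc d) f τ t =
  cong₂ _+_ (trans (shellSum-translate cs d f τ (t ⊕ c)) (cong (shellSum cs d f) (xy∙z≈xz∙y t c τ)))
            (shellSum-translate cs (suc d) f τ t)
  where open ⊕-Properties

weight≡2⇒isEven : ∀ {n} (e : Vec Bool n) → (weight e ≡ᵇ 2) ≡ true → isEven e ≡ true
weight≡2⇒isEven e w≡2 = cong (λ k → k % 2 ≡ᵇ 0) (≡ᵇ-sound {weight e} w≡2)

neighbour-⊕ : ∀ {n} (v : Vec Bool n) → isEven v ≡ true → ∀ e y →
  isEven (v ⊕ e) ∧ adjᵇ v (v ⊕ e) ∧ y ≡ (weight e ≡ᵇ 2) ∧ y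
neighbour-⊕ v ev e y rewrite dist-⊕ v e with weight e ≡ᵇ 2 in w≡2
... | true = cong (_∧ y) (isEven-⊕ v e ev (weight≡2⇒isEven e w≡2))
... | false = ∧-zeroʳ (isEven (v ⊕ e))

hasColour-∘ : ∀ {m n} (X : Vec Bool m → Bool) (f : Vec Bool n → Vec Bool m) j w →
  hasColour (X ∘ f) j w ≡ hasColour X j (f w)
hasColour-∘ X f true w = refl
hasColour-∘ X f false w = refl

nbrCount-syn : ∀ {m n} (cs : Vec (Vec Bool m) n) (B : Vec Bool m → Bool) j v → isEven v ≡ true →
  nbrCount (B ∘ syn cs) j v ≡ shellSum cs 2 (⟦_⟧ ∘ hasColour B j) (syn cs v)
nbrCount-syn {n = n} cs B j v ev = begin
  count (λ w → isEven w ∧ adjᵇ v w ∧ hasColour (B ∘ syn cs) j w) (words n)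
    ≡⟨ count-words-⊕ v _ ⟩
  count (λ e → isEven (v ⊕ e) ∧ adjᵇ v (v ⊕ e) ∧ hasColour (B ∘ syn cs) j (v ⊕ e)) (words n)
    ≡⟨ count-cong neighbour-syn (words n) ⟩
  count (inShell cs 2 (hasColour B j) (syn cs v)) (words n)
    ≡⟨ count-shell cs 2 (hasColour B j) (syn cs v) ⟩
  shellSum cs 2 (⟦_⟧ ∘ hasColour B j) (syn cs v)
    ∎
  where
  open ≡-Reasoning
  neighbour-syn : ∀ e → isEven (v ⊕ e) ∧ adjᵇ v (v ⊕ e) ∧ hasColour (B ∘ syn cs) j (v ⊕ e)
                      ≡ inShell cs 2 (hasColour B j) (syn cs v) e
  neighbour-syn e = trans (neighbour-⊕ v ev e _)
    (cong ((weight e ≡ᵇ 2) ∧_)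
          (trans (hasColour-∘ B (syn cs) j (v ⊕ e)) (cong (hasColour B j) (syn-⊕ cs v e))))

-- For f = ⟦_⟧ ∘ B this says that, in the graph on syndromes joining s to s ⊕ syn cs e for the
-- words e of weight two, each s with head s ≡ k has θ + c neighbours in B if s ∈ B and c otherwise.
record Equitable {m n} (cs : Vec (Vec Bool (suc m)) n) (k : Bool) (f : Vec Bool (suc m) → ℕ) (θ c : ℕ)
                 : Set where
  field shellSum-eq : ∀ s → head s ≡ k → shellSum cs 2 f s ≡ θ * f s + c

open Equitable

module _ {m n} {cs : Vec (Vec Bool (suc m)) n} {k : Bool} {θ : ℕ} where

  Equitable-cong : ∀ {f g c} → (∀ s → f s ≡ g s) → Equitable cs k f θ c → Equitable cs k g θ c
  Equitable-cong {f} {g} {c} f≗g eq .shellSum-eq s hs = begin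
    shellSum cs 2 g s ≡⟨ shellSum-cong cs 2 f≗g s ⟨
    shellSum cs 2 f s ≡⟨ eq .shellSum-eq s hs ⟩
    θ * f s + c       ≡⟨ cong (λ x → θ * x + c) (f≗g s) ⟩
    θ * g s + c       ∎
    where open ≡-Reasoning

  Equitable-zero : Equitable cs k (λ _ → 0) θ 0
  Equitable-zero .shellSum-eq s hs =
    trans (shellSum-const cs 2 0 s) (sym (trans (+-identityʳ (θ * 0)) (*-zeroʳ θ)))

  Equitable-+ : ∀ {f g c c′} → Equitable cs k f θ c → Equitable cs k g θ c′ →
    Equitable cs k (λ s → f s + g s) θ (c + c′)
  Equitable-+ {f} {g} {c} {c′} eqf eqg .shellSum-eq s hs = begin
    shellSum cs 2 (λ s → f s + g s) s      ≡⟨ shellSum-+ cs 2 f g s ⟩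
    shellSum cs 2 f s + shellSum cs 2 g s  ≡⟨ cong₂ _+_ (eqf .shellSum-eq s hs) (eqg .shellSum-eq s hs) ⟩
    (θ * f s + c) + (θ * g s + c′)         ≡⟨ +-interchange (θ * f s) c (θ * g s) c′ ⟩
    (θ * f s + θ * g s) + (c + c′)         ≡⟨ cong (_+ (c + c′)) (*-distribˡ-+ θ (f s) (g s)) ⟨
    θ * (f s + g s) + (c + c′)             ∎
    where
    open ≡-Reasoning
    open CommutativeSemigroupProperties +-commutativeSemigroup renaming (interchange to +-interchange)

  Equitable-translate : ∀ {f c} τ → Equitable cs (k xor head τ) f θ c →
    Equitable cs k (λ s → f (s ⊕ τ)) θ c
  Equitable-translate {f} τ eq .shellSum-eq s hs =
    trans (shellSum-translate cs 2 f τ s)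
          (eq .shellSum-eq (s ⊕ τ) (trans (head-⊕ s τ) (cong (_xor head τ) hs)))

equitable⇒perfectColoring : ∀ {m n} (cs : Vec (Vec Bool (suc m)) n) → All (λ c → head c ≡ true) cs →
  (B : Vec Bool (suc m) → Bool) {θ c : ℕ} → Equitable cs false (⟦_⟧ ∘ B) θ c →
  (Σ (Vec Bool n) λ w → isEven w ≡ true × B (syn cs w) ≡ true) →
  (Σ (Vec Bool n) λ w → isEven w ≡ true × B (syn cs w) ≡ false) →
  PerfectColoring2 n (B ∘ syn cs) (θ + c) (n choose 2 ∸ (θ + c)) c (n choose 2 ∸ c)
equitable⇒perfectColoring {n = n} cs columns-odd B {θ} {c} B-equitable inside outside =
  inside , outside , counts-in , counts-out
  where
  Counts : Vec Bool n → ℕ → Set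
  Counts v k = nbrCount (B ∘ syn cs) true v ≡ k × nbrCount (B ∘ syn cs) false v ≡ n choose 2 ∸ k

  counts : ∀ v → isEven v ≡ true → Counts v (θ * ⟦ B (syn cs v) ⟧ + c)
  counts v ev = trans (nbrCount-syn cs B true v ev) B-nbrs ,
                trans (nbrCount-syn cs B false v ev)
                      (trans (sym (m+n∸n≡m _ (shellSum cs 2 (⟦_⟧ ∘ B) s))) (cong₂ _∸_ all-nbrs B-nbrs))
    where
    s = syn cs v
    B-nbrs : shellSum cs 2 (⟦_⟧ ∘ B) s ≡ θ * ⟦ B s ⟧ + c
    B-nbrs = B-equitable .shellSum-eq s (trans (head-syn cs columns-odd v) (isEven⇒parity≡false v ev))
    all-nbrs : shellSum cs 2 (⟦_⟧ ∘ not ∘ B) s + shellSum cs 2 (⟦_⟧ ∘ B) s ≡ n choose 2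
    all-nbrs = begin
      shellSum cs 2 (⟦_⟧ ∘ not ∘ B) s + shellSum cs 2 (⟦_⟧ ∘ B) s
        ≡⟨ shellSum-+ cs 2 (⟦_⟧ ∘ not ∘ B) (⟦_⟧ ∘ B) s ⟨
      shellSum cs 2 (λ x → ⟦ not (B x) ⟧ + ⟦ B x ⟧) s
        ≡⟨ shellSum-cong cs 2 (⟦not⟧+⟦⟧ ∘ B) s ⟩
      shellSum cs 2 (λ _ → 1) s
        ≡⟨ shellSum-const cs 2 1 s ⟩
      1 * (n choose 2)
        ≡⟨ *-identityˡ (n choose 2) ⟩
      n choose 2
        ∎
      where open ≡-Reasoning

  counts-in : ∀ v → isEven v ≡ true → B (syn cs v) ≡ true → Counts v (θ + c)
  counts-in v ev Bv =
    subst (Counts v) (trans (cong (λ b → θ * ⟦ b ⟧ + c) Bv) (cong (_+ c) (*-identityʳ θ))) (counts v ev)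

  counts-out : ∀ v → isEven v ≡ true → B (syn cs v) ≡ false → Counts v c
  counts-out v ev Bv =
    subst (Counts v) (trans (cong (λ b → θ * ⟦ b ⟧ + c) Bv) (cong (_+ c) (*-zeroʳ θ))) (counts v ev)

⟦0<ᵇ⟧ : ∀ {k} → k ≤ 1 → ⟦ 0 <ᵇ k ⟧ ≡ k
⟦0<ᵇ⟧ {zero} _ = refl
⟦0<ᵇ⟧ {suc zero} _ = refl
⟦0<ᵇ⟧ {suc (suc k)} (s≤s ())

module Pieces {m n} (cs : Vec (Vec Bool (suc m)) n) (θ : ℕ)
              (base : Bool → Vec Bool (suc m) → Bool) (cOf : Bool → ℕ)
              (base-equitable : ∀ k → Equitable cs k (⟦_⟧ ∘ base k) θ (cOf k)) where

  -- The base set translated by τ is chosen by the parity of τ, so that every piece is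
  -- equitable on the even half.
  piece : Vec Bool (suc m) → Vec Bool (suc m) → Bool
  piece τ s = base (head τ) (s ⊕ τ)

  multiplicity : List (Vec Bool (suc m)) → Vec Bool (suc m) → ℕ
  multiplicity L s = count (λ τ → piece τ s) L

  covered : List (Vec Bool (suc m)) → Vec Bool (suc m) → Bool
  covered L s = 0 <ᵇ multiplicity L s

  total : List (Vec Bool (suc m)) → ℕ
  total L = sum (map (cOf ∘ head) L)

  multiplicity-equitable : ∀ L → Equitable cs false (multiplicity L) θ (total L)
  multiplicity-equitable [] = Equitable-zero
  multiplicity-equitable (τ ∷ L) =
    Equitable-cong (λ s → sym (count-∷ (λ τ → piece τ s) τ L))
      (Equitable-+ (Equitable-translate τ (base-equitable (head τ))) (multiplicity-equitable L))

  covered-equitable : ∀ L → (∀ s → multiplicity L s ≤ 1) →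
    Equitable cs false (⟦_⟧ ∘ covered L) θ (total L)
  covered-equitable L disjoint = Equitable-cong (λ s → sym (⟦0<ᵇ⟧ (disjoint s))) (multiplicity-equitable L)

  multiplicity-mono : ∀ {L L′} → L ⊆ L′ → ∀ s → multiplicity L s ≤ multiplicity L′ s
  multiplicity-mono σ s = count-mono-⊆ (λ τ → piece τ s) σ

allWordsᵇ : ∀ n → (Vec Bool n → Bool) → Bool
allWordsᵇ zero p = p []
allWordsᵇ (suc n) p = allWordsᵇ n (p ∘ (true ∷_)) ∧ allWordsᵇ n (p ∘ (false ∷_))

allWordsᵇ-sound : ∀ n (p : Vec Bool n → Bool) → allWordsᵇ n p ≡ true → ∀ w → p w ≡ true
allWordsᵇ-sound zero p ok [] = ok
allWordsᵇ-sound (suc n) p ok (true ∷ w) = allWordsᵇ-sound n (p ∘ (true ∷_)) (proj₁ (∧≡true ok)) w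
allWordsᵇ-sound (suc n) p ok (false ∷ w) = allWordsᵇ-sound n (p ∘ (false ∷_)) (proj₂ (∧≡true ok)) w

allBelowᵇ : ℕ → (ℕ → Bool) → Bool
allBelowᵇ zero p = true
allBelowᵇ (suc n) p = p n ∧ allBelowᵇ n p

allBelowᵇ-sound : ∀ n (p : ℕ → Bool) → allBelowᵇ n p ≡ true → ∀ i → i < n → p i ≡ true
allBelowᵇ-sound (suc n) p ok i i<1+n with m≤n⇒m<n∨m≡n (s≤s⁻¹ i<1+n)
... | inj₁ i<n = allBelowᵇ-sound n p (proj₂ (∧≡true ok)) i i<n
... | inj₂ refl = proj₁ (∧≡true ok)

equitableAtᵇ : ∀ {m n} → Vec (Vec Bool (suc m)) n → Bool → (Vec Bool (suc m) → Bool) → ℕ → ℕ →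
  Vec Bool (suc m) → Bool
equitableAtᵇ cs k B θ c s = (head s xor k) ∨ (shellSum cs 2 (⟦_⟧ ∘ B) s ≡ᵇ θ * ⟦ B s ⟧ + c)

equitableᵇ : ∀ {m n} → Vec (Vec Bool (suc m)) n → Bool → (Vec Bool (suc m) → Bool) → ℕ → ℕ → Bool
equitableᵇ {m} cs k B θ c = allWordsᵇ (suc m) (equitableAtᵇ cs k B θ c)

equitableᵇ-sound : ∀ {m n} (cs : Vec (Vec Bool (suc m)) n) k B θ c →
  equitableᵇ cs k B θ c ≡ true → Equitable cs k (⟦_⟧ ∘ B) θ c
equitableᵇ-sound {m} cs k B θ c ok .shellSum-eq s hs =
  ≡ᵇ-sound (subst (λ b → b ∨ _ ≡ true) off-half-false
                  (allWordsᵇ-sound (suc m) (equitableAtᵇ cs k B θ c) ok s))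
  where
  off-half-false : head s xor k ≡ false
  off-half-false = trans (cong (_xor k) hs) (xor-same k)

data DecisionTree : ℕ → Set where
  leaf : ∀ {n} → Bool → DecisionTree n
  node : ∀ {n} → DecisionTree n → DecisionTree n → DecisionTree (suc n)

evaluate : ∀ {n} → DecisionTree n → Vec Bool n → Bool
evaluate (leaf b) _ = b
evaluate (node t f) (true ∷ s) = evaluate t s
evaluate (node t f) (false ∷ s) = evaluate f s

Syndrome : Set
Syndrome = Vec Bool 12

-- The columns of a parity-check matrix of the extended binary Golay code. Their first
-- entries are all 1, so the first bit of a syndrome is the parity of the word.
golay : Vec Syndrome 24
golay =
  ( true ∷ false ∷ false ∷ false ∷ false ∷ false ∷ false ∷ true ∷ false ∷ true ∷ true ∷ true ∷ [])
  ∷ (true ∷ false ∷ false ∷ false ∷ false ∷ false ∷ true ∷ true ∷ true ∷ true ∷ false ∷ false ∷ [])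
  ∷ (true ∷ false ∷ false ∷ false ∷ false ∷ false ∷ true ∷ false ∷ true ∷ false ∷ false ∷ true ∷ [])
  ∷ (true ∷ false ∷ false ∷ false ∷ false ∷ false ∷ true ∷ false ∷ false ∷ false ∷ true ∷ true ∷ [])
  ∷ (true ∷ false ∷ false ∷ false ∷ false ∷ false ∷ true ∷ false ∷ false ∷ true ∷ true ∷ false ∷ [])
  ∷ (true ∷ true ∷ false ∷ true ∷ true ∷ false ∷ true ∷ true ∷ false ∷ false ∷ true ∷ true ∷ [])
  ∷ (true ∷ true ∷ true ∷ false ∷ true ∷ false ∷ false ∷ true ∷ true ∷ false ∷ false ∷ true ∷ [])
  ∷ (true ∷ false ∷ false ∷ false ∷ false ∷ false ∷ false ∷ true ∷ true ∷ false ∷ true ∷ true ∷ [])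
  ∷ (true ∷ true ∷ false ∷ true ∷ false ∷ true ∷ true ∷ false ∷ true ∷ true ∷ false ∷ true ∷ [])
  ∷ (true ∷ true ∷ false ∷ true ∷ true ∷ true ∷ false ∷ true ∷ false ∷ true ∷ true ∷ false ∷ [])
  ∷ (true ∷ false ∷ false ∷ false ∷ false ∷ false ∷ false ∷ true ∷ true ∷ true ∷ false ∷ false ∷ [])
  ∷ (true ∷ true ∷ true ∷ true ∷ false ∷ false ∷ true ∷ false ∷ true ∷ true ∷ true ∷ false ∷ [])
  ∷ (true ∷ false ∷ false ∷ false ∷ false ∷ false ∷ false ∷ false ∷ false ∷ false ∷ false ∷ false ∷ [])
  ∷ (true ∷ true ∷ true ∷ true ∷ true ∷ true ∷ true ∷ false ∷ false ∷ false ∷ false ∷ false ∷ [])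
  ∷ (true ∷ true ∷ true ∷ false ∷ true ∷ true ∷ false ∷ true ∷ false ∷ false ∷ false ∷ false ∷ [])
  ∷ (true ∷ true ∷ false ∷ false ∷ true ∷ true ∷ false ∷ false ∷ true ∷ false ∷ false ∷ false ∷ [])
  ∷ (true ∷ true ∷ true ∷ true ∷ true ∷ false ∷ false ∷ false ∷ false ∷ true ∷ false ∷ false ∷ [])
  ∷ (true ∷ true ∷ true ∷ true ∷ false ∷ true ∷ false ∷ false ∷ false ∷ false ∷ true ∷ false ∷ [])
  ∷ (true ∷ true ∷ true ∷ false ∷ false ∷ true ∷ false ∷ false ∷ false ∷ false ∷ false ∷ true ∷ [])
  ∷ (true ∷ true ∷ true ∷ false ∷ false ∷ false ∷ false ∷ false ∷ false ∷ false ∷ false ∷ false ∷ [])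
  ∷ (true ∷ true ∷ false ∷ true ∷ false ∷ false ∷ false ∷ false ∷ false ∷ false ∷ false ∷ false ∷ [])
  ∷ (true ∷ true ∷ false ∷ false ∷ true ∷ false ∷ false ∷ false ∷ false ∷ false ∷ false ∷ false ∷ [])
  ∷ (true ∷ true ∷ false ∷ false ∷ false ∷ true ∷ false ∷ false ∷ false ∷ false ∷ false ∷ false ∷ [])
  ∷ (true ∷ true ∷ false ∷ false ∷ false ∷ false ∷ false ∷ false ∷ false ∷ false ∷ false ∷ false ∷ [])
  ∷ []

golay-columns-odd : All (λ c → head c ≡ true) golay
golay-columns-odd = toWitness {a? = all? (λ c → head c Bool.≟ true) golay} _

isZero : ∀ {n} → Vec Bool n → Bool
isZero [] = true
isZero (x ∷ u) = not x ∧ isZero u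

P₀ : Syndrome → Bool
P₀ s = any (λ c → isZero (s ⊕ c)) (toList golay)

Q₀ : Syndrome → Bool
Q₀ s = isZero (Vec.take 6 s)

-- P₀ as a decision tree on the syndrome bits: evaluating it is far cheaper than scanning the
-- columns, which matters in the exhaustive check of base-equitable.
columnTree : DecisionTree 12
columnTree = (node (node (node (node (node (node (node (node (leaf false) (node (leaf false) (node (leaf false) (node (leaf false) (node (leaf false) (leaf true)))))) (leaf false)) (node (leaf false) (node (leaf false) (node (leaf false) (node (node (leaf false) (node (leaf false) (leaf true))) (leaf false)))))) (node (node (leaf false) (node (leaf false) (node (leaf false) (node (leaf false) (node (node (leaf false) (leaf true)) (leaf false)))))) (node (node (leaf false) (node (node (node (node (leaf false) (leaf true)) (leaf false)) (leaf false)) (leaf false))) (leaf false)))) (node (node (node (leaf false) (node (node (leaf false) (node (leaf false) (node (leaf false) (node (leaf false) (leaf true))))) (leaf false))) (node (leaf false) (node (node (node (leaf false) (node (leaf false) (node (leaf true) (leaf false)))) (leaf false)) (leaf false)))) (node (node (leaf false) (node (leaf false) (node (leaf false) (node (leaf false) (node (leaf false) (node (leaf true) (leaf false))))))) (node (leaf false) (node (leaf false) (node (leaf false) (node (leaf false) (node (leaf false) (node (leaf false) (leaf true)))))))))) (node (node (node (node (leaf false) (node (node (leaf false) (node (node (node (leaf false) (leaf true)) (leaf false)) (leaf false))) (leaf false))) (node (node (node (leaf false) (node (leaf false) (node (node (leaf true) (leaf false)) (leaf false)))) (leaf false)) (leaf false))) (node (node (node (leaf false) (node (node (node (leaf false)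 (node (leaf true) (leaf false))) (leaf false)) (leaf false))) (leaf false)) (node (leaf false) (node (leaf false) (node (leaf false) (node (leaf false) (node (leaf false) (node (leaf false) (leaf true))))))))) (node (node (node (leaf false) (node (leaf false) (node (node (leaf false) (node (leaf false) (node (leaf false) (leaf true)))) (leaf false)))) (node (leaf false) (node (leaf false) (node (leaf false) (node (leaf false) (node (leaf false) (node (leaf false) (leaf true)))))))) (node (node (leaf false) (node (leaf false) (node (leaf false) (node (leaf false) (node (leaf false) (node (leaf false) (leaf true))))))) (node (leaf false) (node (leaf false) (node (leaf false) (node (leaf false) (node (leaf false) (node (leaf false) (leaf true))))))))))) (node (leaf false) (node (leaf false) (node (leaf false) (node (leaf false) (node (node (node (node (node (leaf false) (node (leaf false) (leaf true))) (leaf false)) (leaf false)) (node (node (leaf false) (node (leaf false) (node (leaf true) (leaf false)))) (node (node (node (leaf false) (leaf true)) (leaf false)) (node (node (leaf true) (leaf false)) (leaf false))))) (node (node (node (node (leaf false) (node (leaf false) (leaf true))) (node (node (leaf true) (leaf false)) (leaf false))) (node (node (node (leaf true) (leaf false)) (leaf false)) (leaf false))) (node (leaf false) (node (leaf false) (node (leaf false) (node (leaf false) (leaf true)))))))))))) (leaf false))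

columnTree-correct : ∀ s → evaluate columnTree s ≡ P₀ s
columnTree-correct s =
  toWitness {a? = evaluate columnTree s Bool.≟ P₀ s}
    (Equivalence.from T-≡
      (allWordsᵇ-sound 12 (λ s → isYes (evaluate columnTree s Bool.≟ P₀ s)) refl s))

base : Bool → Syndrome → Bool
base true = P₀
base false = Q₀

cOf : Bool → ℕ
cOf true = 3
cOf false = 8

-- Checked exhaustively. For P₀ the reason is that the odd cosets of the Golay code are led by
-- the 24 words of weight one and the 2024 words of weight three.
base-equitable : ∀ k → Equitable golay k (⟦_⟧ ∘ base k) 20 (cOf k)
base-equitable true =
  Equitable-cong (cong ⟦_⟧ ∘ columnTree-correct)
    (equitableᵇ-sound golay true (evaluate columnTree) 20 3 refl)
base-equitable false = equitableᵇ-sound golay false Q₀ 20 8 refl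

open Pieces golay 20 base cOf base-equitable

Ps : List Syndrome
Ps =
  ( true ∷ false ∷ false ∷ false ∷ false ∷ false ∷ false ∷ true ∷ false ∷ false ∷ true ∷ true ∷ [])
  ∷ (true ∷ false ∷ false ∷ false ∷ false ∷ false ∷ false ∷ true ∷ false ∷ false ∷ false ∷ true ∷ [])
  ∷ (true ∷ false ∷ false ∷ false ∷ false ∷ false ∷ true ∷ false ∷ true ∷ false ∷ true ∷ false ∷ [])
  ∷ (true ∷ false ∷ false ∷ false ∷ false ∷ false ∷ true ∷ true ∷ true ∷ true ∷ true ∷ false ∷ [])
  ∷ (true ∷ false ∷ false ∷ false ∷ false ∷ false ∷ false ∷ false ∷ false ∷ true ∷ true ∷ true ∷ [])
  ∷ (true ∷ false ∷ false ∷ false ∷ false ∷ false ∷ false ∷ false ∷ false ∷ true ∷ false ∷ true ∷ [])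
  ∷ (true ∷ false ∷ false ∷ false ∷ false ∷ false ∷ true ∷ true ∷ true ∷ true ∷ false ∷ false ∷ [])
  ∷ []

Qs : List Syndrome
Qs =
  ( false ∷ false ∷ false ∷ false ∷ false ∷ false ∷ false ∷ false ∷ false ∷ false ∷ false ∷ false ∷ [])
  ∷ (false ∷ false ∷ false ∷ false ∷ false ∷ true ∷ false ∷ false ∷ false ∷ false ∷ false ∷ false ∷ [])
  ∷ (false ∷ false ∷ false ∷ false ∷ true ∷ false ∷ false ∷ false ∷ false ∷ false ∷ false ∷ false ∷ [])
  ∷ (false ∷ false ∷ false ∷ false ∷ true ∷ true ∷ false ∷ false ∷ false ∷ false ∷ false ∷ false ∷ [])
  ∷ (false ∷ false ∷ false ∷ true ∷ false ∷ false ∷ false ∷ false ∷ false ∷ false ∷ false ∷ false ∷ [])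
  ∷ (false ∷ false ∷ false ∷ true ∷ false ∷ true ∷ false ∷ false ∷ false ∷ false ∷ false ∷ false ∷ [])
  ∷ (false ∷ false ∷ false ∷ true ∷ true ∷ false ∷ false ∷ false ∷ false ∷ false ∷ false ∷ false ∷ [])
  ∷ (false ∷ false ∷ false ∷ true ∷ true ∷ true ∷ false ∷ false ∷ false ∷ false ∷ false ∷ false ∷ [])
  ∷ (false ∷ false ∷ true ∷ false ∷ false ∷ false ∷ false ∷ false ∷ false ∷ false ∷ false ∷ false ∷ [])
  ∷ (false ∷ false ∷ true ∷ false ∷ false ∷ true ∷ false ∷ false ∷ false ∷ false ∷ false ∷ false ∷ [])
  ∷ (false ∷ false ∷ true ∷ false ∷ true ∷ false ∷ false ∷ false ∷ false ∷ false ∷ false ∷ false ∷ [])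
  ∷ (false ∷ false ∷ true ∷ false ∷ true ∷ true ∷ false ∷ false ∷ false ∷ false ∷ false ∷ false ∷ [])
  ∷ (false ∷ false ∷ true ∷ true ∷ false ∷ false ∷ false ∷ false ∷ false ∷ false ∷ false ∷ false ∷ [])
  ∷ (false ∷ false ∷ true ∷ true ∷ false ∷ true ∷ false ∷ false ∷ false ∷ false ∷ false ∷ false ∷ [])
  ∷ (false ∷ false ∷ true ∷ true ∷ true ∷ false ∷ false ∷ false ∷ false ∷ false ∷ false ∷ false ∷ [])
  ∷ (false ∷ false ∷ true ∷ true ∷ true ∷ true ∷ false ∷ false ∷ false ∷ false ∷ false ∷ false ∷ [])
  ∷ []

witnessP : Vec Bool 24
witnessP = true ∷ false ∷ true ∷ false ∷ true ∷ false ∷ false ∷ false ∷ false ∷ false ∷ true ∷ false ∷ false ∷ false ∷ false ∷ false ∷ false ∷ false ∷ false ∷ false ∷ false ∷ false ∷ false ∷ false ∷ []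

witnessQ : Vec Bool 24
witnessQ = false ∷ false ∷ false ∷ false ∷ false ∷ false ∷ false ∷ false ∷ false ∷ false ∷ false ∷ false ∷ false ∷ false ∷ false ∷ false ∷ false ∷ false ∷ false ∷ false ∷ false ∷ false ∷ true ∷ true ∷ []

witnessOutside : Vec Bool 24
witnessOutside = false ∷ false ∷ false ∷ false ∷ false ∷ false ∷ false ∷ false ∷ false ∷ false ∷ false ∷ false ∷ true ∷ false ∷ false ∷ false ∷ false ∷ false ∷ false ∷ false ∷ false ∷ false ∷ false ∷ true ∷ []

-- Among all these translates, only the first one of Qs meets any other.
Ps++Qs⁺ : List Syndrome
Ps++Qs⁺ = Ps ++ drop 1 Qs

disjointᵇ : List Syndrome → Bool
disjointᵇ L = allWordsᵇ 12 (λ s → multiplicity L s ≤ᵇ 1)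

disjointᵇ-sound : ∀ L → disjointᵇ L ≡ true → ∀ s → multiplicity L s ≤ 1
disjointᵇ-sound L ok s =
  ≤ᵇ⇒≤ _ 1 (Equivalence.from T-≡ (allWordsᵇ-sound 12 (λ s → multiplicity L s ≤ᵇ 1) ok s))

insideᵇ outsideᵇ : List Syndrome → Vec Bool 24 → Bool
insideᵇ L u = isEven u ∧ covered L (syn golay u)
outsideᵇ L v = isEven v ∧ not (covered L (syn golay v))

realisesᵇ : List Syndrome → ℕ → Vec Bool 24 → Vec Bool 24 → Bool
realisesᵇ L c u v = (total L ≡ᵇ c) ∧ insideᵇ L u ∧ outsideᵇ L v

Coloring : ℕ → Set
Coloring c = Σ (Vec Bool 24 → Bool) λ C → PerfectColoring2 24 C (20 + c) (256 ∸ c) c (276 ∸ c)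

coloringFromPieces : ∀ F → disjointᵇ F ≡ true → ∀ L → L ⊆ F → ∀ c u v → realisesᵇ L c u v ≡ true →
  Coloring c
coloringFromPieces F F-disjoint L L⊆F c u v ok = subst Coloring total≡c (covered L ∘ syn golay , perfect)
  where
  total≡c : total L ≡ c
  total≡c = ≡ᵇ-sound (proj₁ (∧≡true ok))
  witnesses : insideᵇ L u ≡ true × outsideᵇ L v ≡ true
  witnesses = ∧≡true {insideᵇ L u} (proj₂ (∧≡true {total L ≡ᵇ c} ok))
  L-disjoint : ∀ s → multiplicity L s ≤ 1
  L-disjoint s = ≤-trans (multiplicity-mono L⊆F s) (disjointᵇ-sound F F-disjoint s)
  perfect : PerfectColoring2 24 (covered L ∘ syn golay)
                             (20 + total L) (256 ∸ total L) (total L) (276 ∸ total L)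
  perfect = equitable⇒perfectColoring golay golay-columns-odd (covered L) (covered-equitable L L-disjoint)
    (u , ∧≡true {isEven u} (proj₁ witnesses))
    (v , map₂ not-injective (∧≡true {isEven v} (proj₂ witnesses)))

-- c = 3b + 8a with b ≡ 3c (mod 8), since 3 is its own inverse modulo 8.
translatesOf3 translatesOf8 : ℕ → ℕ
translatesOf3 c = (3 * c) % 8
translatesOf8 c = (c ∸ 3 * translatesOf3 c) / 8

selection : ℕ → List Syndrome
selection c = take (translatesOf3 c) Ps ++ take (translatesOf8 c) (drop 1 Qs)

selection⊆Ps++Qs⁺ : ∀ c → selection c ⊆ Ps++Qs⁺
selection⊆Ps++Qs⁺ c = ++⁺ (take-⊆ (translatesOf3 c) Ps) (take-⊆ (translatesOf8 c) (drop 1 Qs))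

insideWitness : ℕ → Vec Bool 24
insideWitness c = if 1 ≤ᵇ translatesOf3 c then witnessP else witnessQ

realisedᵇ : ℕ → Bool
realisedᵇ c = realisesᵇ (selection c) c (insideWitness c) witnessOutside

coloringFromSelection : ∀ c → realisedᵇ c ≡ true → Coloring c
coloringFromSelection c =
  coloringFromPieces Ps++Qs⁺ refl (selection c) (selection⊆Ps++Qs⁺ c) c (insideWitness c) witnessOutside

realisedᵇ-from14 : ∀ c → 14 ≤ c → c < 128 → realisedᵇ c ≡ true
realisedᵇ-from14 c 14≤c c<128 = subst (λ c → realisedᵇ c ≡ true) (m+[n∸m]≡n 14≤c)
  (allBelowᵇ-sound 114 (realisedᵇ ∘ (14 +_)) refl (c ∸ 14) (∸-monoˡ-< c<128 14≤c))

coloringFrom14 : ∀ c → 14 ≤ c → c < 128 ⊎ c ≡ 128 → Coloring c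
coloringFrom14 c 14≤c (inj₁ c<128) = coloringFromSelection c (realisedᵇ-from14 c 14≤c c<128)
coloringFrom14 .128 _ (inj₂ refl) = coloringFromPieces Qs refl Qs ⊆-refl 128 𝟘 witnessOutside refl

theorem1 : (c : ℕ) →
    (c ≡ 3 ⊎ c ≡ 6 ⊎ c ≡ 8 ⊎ c ≡ 9 ⊎ c ≡ 11 ⊎ c ≡ 12 ⊎ (14 ≤ c × c ≤ 128)) →
    Σ (Vec Bool 24 → Bool) λ C →
      PerfectColoring2 24 C (20 + c) (256 ∸ c) c (276 ∸ c)
theorem1 c (inj₁ refl) = coloringFromSelection 3 refl
theorem1 c (inj₂ (inj₁ refl)) = coloringFromSelection 6 refl
theorem1 c (inj₂ (inj₂ (inj₁ refl))) = coloringFromSelection 8 refl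
theorem1 c (inj₂ (inj₂ (inj₂ (inj₁ refl)))) = coloringFromSelection 9 refl
theorem1 c (inj₂ (inj₂ (inj₂ (inj₂ (inj₁ refl))))) = coloringFromSelection 11 refl
theorem1 c (inj₂ (inj₂ (inj₂ (inj₂ (inj₂ (inj₁ refl)))))) = coloringFromSelection 12 refl
theorem1 c (inj₂ (inj₂ (inj₂ (inj₂ (inj₂ (inj₂ (14≤c , c≤128))))))) =
  coloringFrom14 c 14≤c (m≤n⇒m<n∨m≡n c≤128)
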